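{- Let $G$ be a connected pseudo $3$-regular graph with maximum degree $4$, and for $j=1,2,3,4$ let $a_j=|\{i\in V(G)\mid d_i=j\}|$. Then (i) $a_1+a_2=2a_4$; (ii) $|V(G)|=a_3+3a_4$; (iii) $a_1\leq a_3$; (iv) $a_1,a_2,a_3$ all have the same parity.
   Context: All graphs are finite, simple and without isolated vertices. For a vertex $i$, $d_i$ is its degree and $m_i=d_i^{ -1}\sum_{j:\, ji\in E(G)} d_j$ is its average $2$-degree. A graph is $k$-harmonic if $m_i=k$ for all vertices $i$; it is pseudo $k$-regular if it is $k$-harmonic but not $k$-regular. -}

module Defs where

open import Data.Nat using (ℕ; zero; suc; _+_; _*_; _≤_; _≡ᵇ_)
open import Data.Fin using (Fin)
open import Data.Bool using (Bool; true; false; if_then_else_)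
open import Data.List using (map; allFin)
open import Data.Nat.ListAction using (sum)
open import Data.Product using (∃)
open import Relation.Binary.PropositionalEquality using (_≡_)
open import Relation.Nullary using (¬_)

Σᶠ : {n : ℕ} → (Fin n → ℕ) → ℕ
Σᶠ {n} f = sum (map f (allFin n))

record Graph (n : ℕ) : Set where
  field
    adj    : Fin n → Fin n → Bool
    sym    : ∀ i j → adj i j ≡ adj j i
    irrefl : ∀ i → adj i i ≡ false
open Graph public

deg : {n : ℕ} → Graph n → Fin n → ℕ
deg G i = Σᶠ (λ j → if adj G i j then 1 else 0)

nbrDegSum : {n : ℕ} → Graph n → Fin n → ℕ
nbrDegSum G i = Σᶠ (λ j → if adj G i j then deg G j else 0)

NoIsolated : {n : ℕ} → Graph n → Set
NoIsolated G = ∀ i → 1 ≤ deg G i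

data Reach {n : ℕ} (G : Graph n) : Fin n → Fin n → Set where
  here : ∀ {i} → Reach G i i
  step : ∀ {i j k} → adj G i j ≡ true → Reach G j k → Reach G i k

Connected : {n : ℕ} → Graph n → Set
Connected G = ∀ i j → Reach G i j

-- m_i = k, written as  Σ_{j ~ i} d_j = k * d_i  (d_i ≥ 1 since no isolated vertices)
Harmonic : {n : ℕ} → Graph n → ℕ → Set
Harmonic G k = ∀ i → nbrDegSum G i ≡ k * deg G i

Regular : {n : ℕ} → Graph n → ℕ → Set
Regular G k = ∀ i → deg G i ≡ k

PseudoRegular : {n : ℕ} → Graph n → ℕ → Set
PseudoRegular G k = Harmonic G k × ¬ Regular G k
  where open import Data.Product using (_×_)

MaxDegree : {n : ℕ} → Graph n → ℕ → Set
MaxDegree G Δ = (∀ i → deg G i ≤ Δ) × ∃ (λ i → deg G i ≡ Δ)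
  where open import Data.Product using (_×_)

countDeg : {n : ℕ} → Graph n → ℕ → ℕ
countDeg G j = Σᶠ (λ i → if deg G i ≡ᵇ j then 1 else 0)

module Submission where

-- Write d for the degree function and a_k for the number of vertices of
-- degree k; every degree lies in {1,2,3,4}, so any vertex sum Σ_i h(d_i)
-- equals h(1)a_1 + h(2)a_2 + h(3)a_3 + h(4)a_4.  Three global identities
-- then give (i), (ii) and (iv):
--   * n = Σ_i 1 = a_1 + a_2 + a_3 + a_4;
--   * double counting of edges gives Σ_i d_i² = Σ_i Σ_{j~i} d_j, which is
--     Σ_i 3 d_i for a 3-harmonic graph; comparing with Σ_i d_i yields
--     a_1 + a_2 = 2 a_4;
--   * the handshake lemma: Σ_i d_i is even.
-- For (iii) we double count the edges joining a leaf to a degree-3 vertex: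
-- the unique neighbour of a leaf has degree 3 (harmonicity), while a
-- degree-3 vertex has at most one leaf neighbour (its neighbour degrees
-- sum to 9 and are at most 4).

open import Defs hiding (sym; irrefl)
open import Data.Nat using (ℕ; zero; suc; _+_; _*_; _≤_; _%_; _≡ᵇ_; z≤n; s≤s)
open import Data.Nat.Properties
open import Data.Nat.DivMod using ([m+kn]%n≡m%n)
open import Data.Nat.Tactic.RingSolver using (solve-∀)
open import Data.Nat.ListAction using () renaming (sum to listSum)
open import Algebra.Properties.Semiring.Sum +-*-semiring
  using (sum; sum-cong-≗; ∑-distrib-+; ∑-comm; *-distribˡ-sum)
open import Data.Fin using (Fin; zero; suc)
open import Data.Bool using (Bool; true; false; T; if_then_else_)
open import Data.Unit using (tt)
open import Data.List using (map; tabulate)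
open import Data.List.Properties using (map-tabulate)
open import Data.Product using (_×_; _,_; ∃)
open import Function using (_∘_; id)
open import Relation.Binary.PropositionalEquality

Σᶠ≡sum : ∀ {n} (f : Fin n → ℕ) → Σᶠ f ≡ sum f
Σᶠ≡sum {zero}  f = refl
Σᶠ≡sum {suc n} f = cong (f zero +_) (begin
    listSum (map f (tabulate suc))
  ≡⟨ cong listSum (map-tabulate suc f) ⟩
    listSum (tabulate (f ∘ suc))
  ≡⟨ cong listSum (sym (map-tabulate id (f ∘ suc))) ⟩
    Σᶠ (f ∘ suc)
  ≡⟨ Σᶠ≡sum (f ∘ suc) ⟩
    sum (f ∘ suc) ∎)
  where open ≡-Reasoning

∑-one : ∀ n → sum {n} (λ _ → 1) ≡ n
∑-one zero    = refl
∑-one (suc n) = cong suc (∑-one n)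

∑-mono-≤ : ∀ {n} {f g : Fin n → ℕ} → (∀ i → f i ≤ g i) → sum f ≤ sum g
∑-mono-≤ {zero}  _   = z≤n
∑-mono-≤ {suc n} f≤g = +-mono-≤ (f≤g zero) (∑-mono-≤ (f≤g ∘ suc))

⟦_⟧ : Bool → ℕ
⟦ b ⟧ = if b then 1 else 0

if≡⟦⟧* : ∀ b y → (if b then y else 0) ≡ ⟦ b ⟧ * y
if≡⟦⟧* true  y = sym (*-identityˡ y)
if≡⟦⟧* false y = refl

⟦≡ᵇ-refl⟧ : ∀ k → ⟦ k ≡ᵇ k ⟧ ≡ 1
⟦≡ᵇ-refl⟧ zero    = refl
⟦≡ᵇ-refl⟧ (suc k) = ⟦≡ᵇ-refl⟧ k

⟦⟧*-≡ : ∀ b y → (T b → y ≡ 1) → ⟦ b ⟧ * y ≡ ⟦ b ⟧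
⟦⟧*-≡ true  y y≡1 = trans (*-identityˡ y) (y≡1 tt)
⟦⟧*-≡ false y _   = refl

⟦⟧*-≤ : ∀ b y → (T b → y ≤ 1) → ⟦ b ⟧ * y ≤ ⟦ b ⟧
⟦⟧*-≤ true  y y≤1 = subst (_≤ 1) (sym (*-identityˡ y)) (y≤1 tt)
⟦⟧*-≤ false y _   = z≤n

∑-select-none : ∀ {n} (b : Fin n → Bool) (x : Fin n → ℕ) →
  sum (⟦_⟧ ∘ b) ≡ 0 → sum (λ j → ⟦ b j ⟧ * x j) ≡ 0
∑-select-none {zero}  b x _ = refl
∑-select-none {suc n} b x none with b zero
... | false = ∑-select-none (b ∘ suc) (x ∘ suc) none

∑-select-one : ∀ {n} (b : Fin n → Bool) (x : Fin n → ℕ) (h : ℕ → ℕ) →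
  sum (⟦_⟧ ∘ b) ≡ 1 → sum (λ j → ⟦ b j ⟧ * h (x j)) ≡ h (sum (λ j → ⟦ b j ⟧ * x j))
∑-select-one {suc n} b x h one with b zero
... | false = ∑-select-one (b ∘ suc) (x ∘ suc) h one
... | true
  rewrite ∑-select-none (b ∘ suc) (h ∘ x ∘ suc) (suc-injective one)
        | ∑-select-none (b ∘ suc) (x ∘ suc) (suc-injective one)
  = trans (single (h (x zero))) (cong h (sym (single (x zero))))
  where
  single : ∀ y → 1 * y + 0 ≡ y
  single y = trans (+-identityʳ (1 * y)) (*-identityˡ y)

-- Handshake lemma for a symmetric Boolean matrix with empty diagonal: the
-- number of true entries is even (off-diagonal entries come in pairs).
symmetric-count-even : ∀ {n} (a : Fin n → Fin n → Bool) →
  (∀ i j → a i j ≡ a j i) → (∀ i → a i i ≡ false) →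
  ∃ λ m → sum (λ i → sum (λ j → ⟦ a i j ⟧)) ≡ 2 * m
symmetric-count-even {zero}  a _ _ = 0 , refl
symmetric-count-even {suc n} a a-sym a-irr
  with symmetric-count-even (λ i j → a (suc i) (suc j))
         (λ i j → a-sym (suc i) (suc j)) (a-irr ∘ suc)
... | m , rest≡2m = row + m , (begin
    ⟦ a zero zero ⟧ + row + sum (λ i → ⟦ a (suc i) zero ⟧ + rest i)
  ≡⟨ cong₂ _+_ (cong (λ b → ⟦ b ⟧ + row) (a-irr zero)) (∑-distrib-+ _ rest) ⟩
    row + (sum (λ i → ⟦ a (suc i) zero ⟧) + sum rest)
  ≡⟨ cong (λ c → row + (c + sum rest)) (sum-cong-≗ (λ i → cong ⟦_⟧ (a-sym (suc i) zero))) ⟩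
    row + (row + sum rest)
  ≡⟨ cong (λ s → row + (row + s)) rest≡2m ⟩
    row + (row + 2 * m)
  ≡⟨ pair row m ⟩
    2 * (row + m) ∎)
  where
  open ≡-Reasoning
  row : ℕ
  row = sum (λ j → ⟦ a zero (suc j) ⟧)
  rest : Fin n → ℕ
  rest i = sum (λ j → ⟦ a (suc i) (suc j) ⟧)
  pair : ∀ r m → r + (r + 2 * m) ≡ 2 * (r + m)
  pair = solve-∀

nbrSum : ∀ {n} → Graph n → (Fin n → ℕ) → Fin n → ℕ
nbrSum G g i = sum (λ j → ⟦ adj G i j ⟧ * g j)

module _ {n : ℕ} (G : Graph n) where

  deg≡nbrSum : ∀ i → deg G i ≡ nbrSum G (λ _ → 1) i
  deg≡nbrSum i = trans (Σᶠ≡sum {n} _) (sum-cong-≗ (λ j → sym (*-identityʳ ⟦ adj G i j ⟧)))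

  nbrDegSum≡nbrSum : ∀ i → nbrDegSum G i ≡ nbrSum G (deg G) i
  nbrDegSum≡nbrSum i = trans (Σᶠ≡sum {n} _) (sum-cong-≗ (λ j → if≡⟦⟧* (adj G i j) (deg G j)))

  nbrSum-+ : ∀ f g i → nbrSum G (λ j → f j + g j) i ≡ nbrSum G f i + nbrSum G g i
  nbrSum-+ f g i = trans (sum-cong-≗ (λ j → *-distribˡ-+ ⟦ adj G i j ⟧ (f j) (g j))) (∑-distrib-+ {n} _ _)

  nbrSum-* : ∀ c f i → nbrSum G (λ j → c * f j) i ≡ c * nbrSum G f i
  nbrSum-* c f i = trans (sum-cong-≗ (λ j → x[cy]≡c[xy] ⟦ adj G i j ⟧ c (f j)))
                         (sym (*-distribˡ-sum {n} c _))
    where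
    x[cy]≡c[xy] : ∀ x c y → x * (c * y) ≡ c * (x * y)
    x[cy]≡c[xy] = solve-∀

  nbrSum-mono : ∀ {f g} → (∀ j → f j ≤ g j) → ∀ i → nbrSum G f i ≤ nbrSum G g i
  nbrSum-mono f≤g i = ∑-mono-≤ (λ j → *-monoʳ-≤ ⟦ adj G i j ⟧ (f≤g j))

  nbrSum-swap : ∀ f g → sum (λ i → f i * nbrSum G g i) ≡ sum (λ j → g j * nbrSum G f j)
  nbrSum-swap f g = begin
      sum (λ i → f i * nbrSum G g i)
    ≡⟨ sum-cong-≗ (λ i → *-distribˡ-sum {n} (f i) _) ⟩
      sum (λ i → sum (λ j → f i * (⟦ adj G i j ⟧ * g j)))
    ≡⟨ ∑-comm {n} {n} _ ⟩
      sum (λ j → sum (λ i → f i * (⟦ adj G i j ⟧ * g j)))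
    ≡⟨ sum-cong-≗ (λ j → sum-cong-≗ (λ i → edge-term i j)) ⟩
      sum (λ j → sum (λ i → g j * (⟦ adj G j i ⟧ * f i)))
    ≡⟨ sum-cong-≗ (λ j → sym (*-distribˡ-sum {n} (g j) _)) ⟩
      sum (λ j → g j * nbrSum G f j) ∎
    where
    open ≡-Reasoning
    reorder : ∀ x e y → x * (e * y) ≡ y * (e * x)
    reorder = solve-∀
    edge-term : ∀ i j → f i * (⟦ adj G i j ⟧ * g j) ≡ g j * (⟦ adj G j i ⟧ * f i)
    edge-term i j = trans (reorder (f i) ⟦ adj G i j ⟧ (g j))
                          (cong (λ b → g j * (⟦ b ⟧ * f i)) (Graph.sym G i j))

  handshake : ∃ λ m → sum (deg G) ≡ 2 * m
  handshake with symmetric-count-even (adj G) (Graph.sym G) (Graph.irrefl G)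
  ... | m , even = m , trans (sum-cong-≗ {n} (λ i → Σᶠ≡sum {n} (λ j → ⟦ adj G i j ⟧))) even

  module _ (k : ℕ) (harmonic : Harmonic G k) where

    harmonic-nbrSum : ∀ i → nbrSum G (deg G) i ≡ k * deg G i
    harmonic-nbrSum i = trans (sym (nbrDegSum≡nbrSum i)) (harmonic i)

    ∑-square-degree : sum (λ i → deg G i * deg G i) ≡ k * sum (deg G)
    ∑-square-degree = begin
        sum (λ i → deg G i * deg G i)
      ≡⟨ sum-cong-≗ (λ i → cong (deg G i *_) (deg≡nbrSum i)) ⟩
        sum (λ i → deg G i * nbrSum G (λ _ → 1) i)
      ≡⟨ nbrSum-swap (λ _ → 1) (deg G) ⟨
        sum (λ i → 1 * nbrSum G (deg G) i)
      ≡⟨ sum-cong-≗ (λ i → trans (*-identityˡ _) (harmonic-nbrSum i)) ⟩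
        sum (λ i → k * deg G i)
      ≡⟨ *-distribˡ-sum k (deg G) ⟨
        k * sum (deg G) ∎
      where open ≡-Reasoning

    leaf-neighbour : ∀ i → deg G i ≡ 1 → nbrSum G (λ j → ⟦ deg G j ≡ᵇ k ⟧) i ≡ 1
    leaf-neighbour i leaf = begin
        nbrSum G (λ j → ⟦ deg G j ≡ᵇ k ⟧) i
      ≡⟨ ∑-select-one (adj G i) (deg G) (λ y → ⟦ y ≡ᵇ k ⟧) one-neighbour ⟩
        ⟦ nbrSum G (deg G) i ≡ᵇ k ⟧
      ≡⟨ cong (λ s → ⟦ s ≡ᵇ k ⟧) (trans (harmonic-nbrSum i) (cong (k *_) leaf)) ⟩
        ⟦ k * 1 ≡ᵇ k ⟧
      ≡⟨ cong (λ s → ⟦ s ≡ᵇ k ⟧) (*-identityʳ k) ⟩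
        ⟦ k ≡ᵇ k ⟧
      ≡⟨ ⟦≡ᵇ-refl⟧ k ⟩
        1 ∎
      where
      open ≡-Reasoning
      one-neighbour : sum (λ j → ⟦ adj G i j ⟧) ≡ 1
      one-neighbour = trans (sym (Σᶠ≡sum {n} _)) leaf

count : ∀ {n} → (Fin n → ℕ) → ℕ → ℕ
count v k = sum (λ i → ⟦ v i ≡ᵇ k ⟧)

countDeg≡count : ∀ {n} (G : Graph n) k → countDeg G k ≡ count (deg G) k
countDeg≡count {n} G k = Σᶠ≡sum {n} _

value-split : ∀ (h : ℕ → ℕ) x → 1 ≤ x → x ≤ 4 →
  h x ≡ h 1 * ⟦ x ≡ᵇ 1 ⟧ + h 2 * ⟦ x ≡ᵇ 2 ⟧ + h 3 * ⟦ x ≡ᵇ 3 ⟧ + h 4 * ⟦ x ≡ᵇ 4 ⟧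
value-split h 1 _ _ = pick₁ (h 1) (h 2) (h 3) (h 4)
  where
  pick₁ : ∀ a b c e → a ≡ a * 1 + b * 0 + c * 0 + e * 0
  pick₁ = solve-∀
value-split h 2 _ _ = pick₂ (h 1) (h 2) (h 3) (h 4)
  where
  pick₂ : ∀ a b c e → b ≡ a * 0 + b * 1 + c * 0 + e * 0
  pick₂ = solve-∀
value-split h 3 _ _ = pick₃ (h 1) (h 2) (h 3) (h 4)
  where
  pick₃ : ∀ a b c e → c ≡ a * 0 + b * 0 + c * 1 + e * 0
  pick₃ = solve-∀
value-split h 4 _ _ = pick₄ (h 1) (h 2) (h 3) (h 4)
  where
  pick₄ : ∀ a b c e → e ≡ a * 0 + b * 0 + c * 0 + e * 1
  pick₄ = solve-∀
value-split h (suc (suc (suc (suc (suc x))))) _ (s≤s (s≤s (s≤s (s≤s ()))))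

∑-by-value : ∀ {n} (v : Fin n → ℕ) → (∀ i → 1 ≤ v i) → (∀ i → v i ≤ 4) → (h : ℕ → ℕ) →
  sum (h ∘ v) ≡ h 1 * count v 1 + h 2 * count v 2 + h 3 * count v 3 + h 4 * count v 4
∑-by-value {n} v 1≤v v≤4 h = begin
    sum (h ∘ v)
  ≡⟨ sum-cong-≗ (λ i → value-split h (v i) (1≤v i) (v≤4 i)) ⟩
    sum (λ i → term 1 i + term 2 i + term 3 i + term 4 i)
  ≡⟨ ∑-distrib-+ _ (term 4) ⟩
    sum (λ i → term 1 i + term 2 i + term 3 i) + sum (term 4)
  ≡⟨ cong (_+ sum (term 4)) (∑-distrib-+ _ (term 3)) ⟩
    sum (λ i → term 1 i + term 2 i) + sum (term 3) + sum (term 4)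
  ≡⟨ cong (λ s → s + sum (term 3) + sum (term 4)) (∑-distrib-+ (term 1) (term 2)) ⟩
    sum (term 1) + sum (term 2) + sum (term 3) + sum (term 4)
  ≡⟨ cong₂ _+_ (cong₂ _+_ (cong₂ _+_ (term-sum 1) (term-sum 2)) (term-sum 3)) (term-sum 4) ⟩
    h 1 * count v 1 + h 2 * count v 2 + h 3 * count v 3 + h 4 * count v 4 ∎
  where
  open ≡-Reasoning
  term : ℕ → Fin n → ℕ
  term k i = h k * ⟦ v i ≡ᵇ k ⟧
  term-sum : ∀ k → sum (term k) ≡ h k * count v k
  term-sum k = sym (*-distribˡ-sum {n} (h k) _)

-- In a 3-harmonic graph with degrees in {1,..,4}, a degree-3 vertex has at
-- most one leaf neighbour: 3·(#leaf neighbours) + 9 ≤ Σ_{j~i} 4 = 12.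
at-most-one-leaf : ∀ {n} (G : Graph n) → Harmonic G 3 → NoIsolated G → (∀ i → deg G i ≤ 4) →
  ∀ i → deg G i ≡ 3 → nbrSum G (λ j → ⟦ deg G j ≡ᵇ 1 ⟧) i ≤ 1
at-most-one-leaf G harmonic 1≤d d≤4 i cubic =
  *-cancelˡ-≤ 3 (+-cancelʳ-≤ 9 (3 * leaves) 3 (begin
      3 * leaves + 9
    ≡⟨ cong (3 * leaves +_) (trans (harmonic-nbrSum G 3 harmonic i) (cong (3 *_) cubic)) ⟨
      3 * leaves + nbrSum G (deg G) i
    ≡⟨ cong (_+ nbrSum G (deg G) i) (nbrSum-* G 3 _ i) ⟨
      nbrSum G (λ j → 3 * ⟦ deg G j ≡ᵇ 1 ⟧) i + nbrSum G (deg G) i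
    ≡⟨ nbrSum-+ G _ (deg G) i ⟨
      nbrSum G (λ j → 3 * ⟦ deg G j ≡ᵇ 1 ⟧ + deg G j) i
    ≤⟨ nbrSum-mono G (λ j → leaf-weight (deg G j) (1≤d j) (d≤4 j)) i ⟩
      nbrSum G (λ _ → 4 * 1) i
    ≡⟨ nbrSum-* G 4 (λ _ → 1) i ⟩
      4 * nbrSum G (λ _ → 1) i
    ≡⟨ cong (4 *_) (trans (sym (deg≡nbrSum G i)) cubic) ⟩
      12 ∎))
  where
  open ≤-Reasoning
  leaves : ℕ
  leaves = nbrSum G (λ j → ⟦ deg G j ≡ᵇ 1 ⟧) i
  leaf-weight : ∀ x → 1 ≤ x → x ≤ 4 → 3 * ⟦ x ≡ᵇ 1 ⟧ + x ≤ 4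
  leaf-weight 1 _ _ = ≤-refl
  leaf-weight 2 _ _ = s≤s (s≤s z≤n)
  leaf-weight 3 _ _ = s≤s (s≤s (s≤s z≤n))
  leaf-weight 4 _ _ = ≤-refl
  leaf-weight (suc (suc (suc (suc (suc x))))) _ (s≤s (s≤s (s≤s (s≤s ()))))

-- a_1 ≤ a_3: double count the leaf–degree-3 edges; each leaf lies on exactly
-- one of them, each degree-3 vertex on at most one.
leaves≤cubic : ∀ {n} (G : Graph n) → Harmonic G 3 → NoIsolated G → (∀ i → deg G i ≤ 4) →
  count (deg G) 1 ≤ count (deg G) 3
leaves≤cubic G harmonic 1≤d d≤4 = begin
    sum (λ j → ⟦ deg G j ≡ᵇ 1 ⟧)
  ≡⟨ sum-cong-≗ (λ j → ⟦⟧*-≡ (deg G j ≡ᵇ 1) _ (leaf-neighbour G 3 harmonic j ∘ ≡ᵇ⇒≡ _ 1)) ⟨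
    sum (λ j → ⟦ deg G j ≡ᵇ 1 ⟧ * nbrSum G (λ i → ⟦ deg G i ≡ᵇ 3 ⟧) j)
  ≡⟨ nbrSum-swap G (λ i → ⟦ deg G i ≡ᵇ 3 ⟧) (λ j → ⟦ deg G j ≡ᵇ 1 ⟧) ⟨
    sum (λ i → ⟦ deg G i ≡ᵇ 3 ⟧ * nbrSum G (λ j → ⟦ deg G j ≡ᵇ 1 ⟧) i)
  ≤⟨ ∑-mono-≤ (λ i → ⟦⟧*-≤ (deg G i ≡ᵇ 3) _
                        (at-most-one-leaf G harmonic 1≤d d≤4 i ∘ ≡ᵇ⇒≡ _ 3)) ⟩
    sum (λ i → ⟦ deg G i ≡ᵇ 3 ⟧) ∎
  where open ≤-Reasoning

same-parity : ∀ a b c m → a + b + 2 * c ≡ 2 * m → a % 2 ≡ b % 2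
same-parity a b c m even = sym (begin
    b % 2
  ≡⟨ [m+kn]%n≡m%n b (a + c) 2 ⟨
    (b + (a + c) * 2) % 2
  ≡⟨ cong (_% 2) (regroup₁ a b c) ⟩
    (a + b + 2 * c + a) % 2
  ≡⟨ cong (λ s → (s + a) % 2) even ⟩
    (2 * m + a) % 2
  ≡⟨ cong (_% 2) (regroup₂ m a) ⟩
    (a + m * 2) % 2
  ≡⟨ [m+kn]%n≡m%n a m 2 ⟩
    a % 2 ∎)
  where
  open ≡-Reasoning
  regroup₁ : ∀ a b c → b + (a + c) * 2 ≡ a + b + 2 * c + a
  regroup₁ = solve-∀
  regroup₂ : ∀ m a → 2 * m + a ≡ a + m * 2
  regroup₂ = solve-∀

-- Σ d² = 3 Σ d in terms of degree counts forces a_1 + a_2 = 2 a_4.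
squares-vs-degrees : ∀ a b c e →
  1 * a + 4 * b + 9 * c + 16 * e ≡ 3 * (1 * a + 2 * b + 3 * c + 4 * e) → a + b ≡ 2 * e
squares-vs-degrees a b c e eq =
  sym (*-cancelˡ-≡ (2 * e) (a + b) 2 (+-cancelˡ-≡ common _ _ (begin
      common + 2 * (2 * e)
    ≡⟨ lhs a b c e ⟩
      1 * a + 4 * b + 9 * c + 16 * e
    ≡⟨ eq ⟩
      3 * (1 * a + 2 * b + 3 * c + 4 * e)
    ≡⟨ rhs a b c e ⟩
      common + 2 * (a + b) ∎)))
  where
  open ≡-Reasoning
  common : ℕ
  common = a + 4 * b + 9 * c + 12 * e
  lhs : ∀ a b c e → a + 4 * b + 9 * c + 12 * e + 2 * (2 * e) ≡ 1 * a + 4 * b + 9 * c + 16 * e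
  lhs = solve-∀
  rhs : ∀ a b c e → 3 * (1 * a + 2 * b + 3 * c + 4 * e) ≡ a + 4 * b + 9 * c + 12 * e + 2 * (a + b)
  rhs = solve-∀

vertex-count : ∀ n a b c e → n ≡ 1 * a + 1 * b + 1 * c + 1 * e → a + b ≡ 2 * e → n ≡ c + 3 * e
vertex-count n a b c e total ab≡2e = begin
    n
  ≡⟨ total ⟩
    1 * a + 1 * b + 1 * c + 1 * e
  ≡⟨ unit a b c e ⟩
    (a + b) + c + e
  ≡⟨ cong (λ s → s + c + e) ab≡2e ⟩
    2 * e + c + e
  ≡⟨ collect e c ⟩
    c + 3 * e ∎
  where
  open ≡-Reasoning
  unit : ∀ a b c e → 1 * a + 1 * b + 1 * c + 1 * e ≡ (a + b) + c + e
  unit = solve-∀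
  collect : ∀ e c → 2 * e + c + e ≡ c + 3 * e
  collect = solve-∀

-- The handshake lemma in terms of degree counts: a_1 ≡ a_3 (mod 2).
odd-degrees-parity : ∀ a b c e m → 1 * a + 2 * b + 3 * c + 4 * e ≡ 2 * m → a % 2 ≡ c % 2
odd-degrees-parity a b c e m even =
  same-parity a c (b + c + 2 * e) m (trans (regroup a b c e) even)
  where
  regroup : ∀ a b c e → a + c + 2 * (b + c + 2 * e) ≡ 1 * a + 2 * b + 3 * c + 4 * e
  regroup = solve-∀

lemma4p11 : (n : ℕ) (G : Graph n) → NoIsolated G → Connected G →
    PseudoRegular G 3 → MaxDegree G 4 →
    (countDeg G 1 + countDeg G 2 ≡ 2 * countDeg G 4)
    × (n ≡ countDeg G 3 + 3 * countDeg G 4)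
    × (countDeg G 1 ≤ countDeg G 3)
    × (countDeg G 1 % 2 ≡ countDeg G 2 % 2 × countDeg G 2 % 2 ≡ countDeg G 3 % 2)
lemma4p11 n G 1≤d _ (harmonic , _) (d≤4 , _)
  rewrite countDeg≡count G 1 | countDeg≡count G 2 | countDeg≡count G 3 | countDeg≡count G 4
  = leaves+twos , vertex-count n (a 1) (a 2) (a 3) (a 4) vertices leaves+twos
  , leaves≤cubic G harmonic 1≤d d≤4
  , a₁≡a₂ , trans (sym a₁≡a₂) a₁≡a₃
  where
  a : ℕ → ℕ
  a = count (deg G)
  by-degree : (h : ℕ → ℕ) → sum (h ∘ deg G) ≡ h 1 * a 1 + h 2 * a 2 + h 3 * a 3 + h 4 * a 4
  by-degree = ∑-by-value (deg G) 1≤d d≤4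
  vertices : n ≡ 1 * a 1 + 1 * a 2 + 1 * a 3 + 1 * a 4
  vertices = trans (sym (∑-one n)) (by-degree (λ _ → 1))
  leaves+twos : a 1 + a 2 ≡ 2 * a 4
  leaves+twos = squares-vs-degrees (a 1) (a 2) (a 3) (a 4)
    (trans (sym (by-degree (λ x → x * x)))
      (trans (∑-square-degree G 3 harmonic) (cong (3 *_) (by-degree id))))
  a₁≡a₂ : a 1 % 2 ≡ a 2 % 2
  a₁≡a₂ = same-parity (a 1) (a 2) 0 (a 4) (trans (+-identityʳ _) leaves+twos)
  a₁≡a₃ : a 1 % 2 ≡ a 3 % 2
  a₁≡a₃ with handshake G
  ... | m , even = odd-degrees-parity (a 1) (a 2) (a 3) (a 4) m (trans (sym (by-degree id)) even)
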